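{- Let $n$, $p$ and $t$ be positive integers, and let $P_{2^p}$ be any ordering of the $2$-uniform path on $2^p$ vertices (i.e., a graph on $2^p$ vertices whose edges form a Hamiltonian path, with an arbitrary total order on its vertices). Then \[ R_<\big(K_{2^n},\underbrace{P_{2^p},\ldots,P_{2^p}}_{t-1}\big)\leq 2^{\frac{1}{p}\left((p+1)^{t-1}(np-1)+1\right)}. \]
   Context: An ordered graph is a graph with a totally ordered vertex set. An ordered graph $G$ is contained in an ordered graph $H$ if there is an injective order-preserving map $V(G)\to V(H)$ sending edges of $G$ to edges of $H$. $K_N$ is the complete graph on $[N]=\{1,\dots,N\}$ with the natural order. For ordered graphs $G_1,\dots,G_t$, $R_<(G_1,\dots,G_t)$ is the least $N$ such that for every coloring $c:E(K_N)\to[t]$ there is a color $j$ such that the graph of edges of color $j$ contains $G_j$. -}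

module Defs where

open import Level using (0ℓ)
open import Data.Nat using (ℕ; zero; suc; _+_; _*_; _∸_; _^_; _≤_)
open import Data.Fin using (Fin; toℕ; _<_)
import Data.Fin as Fin
open import Data.Fin.Permutation using (Permutation′; _⟨$⟩ˡ_)
open import Data.Product using (Σ; _×_; ∃-syntax)
open import Data.Sum using (_⊎_)
open import Relation.Binary.PropositionalEquality using (_≡_; _≢_)

-- An ordered graph: vertex set Fin size with the natural order of Fin,
-- and a symmetric edge relation (irreflexivity/symmetry are not needed
-- for containment, which only inspects pairs u < v).
record OrdGraph : Set₁ where
  field
    size : ℕ
    Edge : Fin size → Fin size → Set
open OrdGraph public

K : ℕ → OrdGraph
K k = record { size = k ; Edge = λ u v → u ≢ v }

-- The ordering of the path given by a permutation π : the vertex at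
-- path position i is π i, so u and v are adjacent iff their path
-- positions π⁻¹ u, π⁻¹ v are consecutive. Every ordering of the path on
-- m vertices (every ordered graph on [m] whose edges form a Hamiltonian
-- path) arises this way.
pathOrd : (m : ℕ) → Permutation′ m → OrdGraph
pathOrd m π = record
  { size = m
  ; Edge = λ u v → (suc (toℕ (π ⟨$⟩ˡ u)) ≡ toℕ (π ⟨$⟩ˡ v))
                 ⊎ (suc (toℕ (π ⟨$⟩ˡ v)) ≡ toℕ (π ⟨$⟩ˡ u)) }

-- An edge t-colouring of K_N: only the values c i j with i < j matter.
Colouring : ℕ → ℕ → Set
Colouring N t = Fin N → Fin N → Fin t

ContainedIn : (G : OrdGraph) {N t : ℕ} → Colouring N t → Fin t → Set
ContainedIn G {N} c j =
  Σ (Fin (size G) → Fin N) λ f →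
    (∀ u v → u < v → f u < f v) ×
    (∀ u v → u < v → Edge G u v → c (f u) (f v) ≡ j)

-- N arrows (G_1,…,G_t): every t-colouring of K_N has some colour j whose
-- colour class contains G_j.  R_<(G_1,…,G_t) ≤ N  iff  Arrows G N
-- holds for some integer at most N (least such N is R_<).
Arrows : {t : ℕ} → (Fin t → OrdGraph) → ℕ → Set
Arrows {t} G N = (c : Colouring N t) → ∃[ j ] ContainedIn (G j) c j

familyKP : (n p s : ℕ) → Permutation′ (2 ^ p) → Fin (suc s) → OrdGraph
familyKP n p s π Fin.zero = K (2 ^ n)
familyKP n p s π (Fin.suc _) = pathOrd (2 ^ p) π

module Submission where

-- Two-colour core (pathOrIndependent): every graph on an increasing list of
-- h(L) vertices, h(0) = 1, h(L+1) = m(2h(L) - 1), contains P or an independent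
-- increasing sublist of 2^L vertices.  For L+1, cut the list into m chunks of
-- 2h(L) - 1 vertices and give path position i the chunk π(i).  Walk along the
-- path keeping a frontier of ≥ h(L) chunk vertices that end walks through the
-- earlier chunks.  The frontier holds an independent I of size 2^L; if ≥ h(L)
-- vertices of the next chunk have no neighbour in the frontier they hold an
-- independent J and I ∪ J has size 2^{L+1}; otherwise the vertices with a
-- neighbour form the next frontier, and a last frontier yields the path.
-- Colour induction (ColourInduction) applies this to the top colour; its
-- independent sets use fewer colours.

open import Defs
open import Data.Nat using (ℕ; zero; suc; _+_; _*_; _∸_; _^_; _≤_)
open import Data.Fin using (Fin)
open import Data.Fin.Permutation using (Permutation′)
open import Data.Product using (Σ; _×_)

open import Data.Nat using (_<_; z≤n; s≤s; _≤?_; _<?_)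
import Data.Nat.Properties as ℕ
open import Data.Fin as F using (toℕ; fromℕ<)
import Data.Fin.Properties as FP
open import Data.Fin.Permutation using (_⟨$⟩ʳ_; _⟨$⟩ˡ_; inverseʳ; inverseˡ)
open import Data.List using (List; []; _∷_; _++_; length; take; drop; filter; allFin)
import Data.List.Properties as LP
open import Data.List.Membership.Propositional using (_∈_; lose; find)
import Data.List.Membership.Propositional.Properties as MP
open import Data.List.Relation.Binary.Subset.Propositional using (_⊆_)
open import Data.List.Relation.Binary.Subset.Propositional.Properties using (filter-⊆)
open import Data.List.Relation.Unary.Any using (Any; here; there; any?)
import Data.List.Relation.Unary.All as All
open import Data.List.Relation.Unary.AllPairs using (AllPairs; []; _∷_)
import Data.List.Relation.Unary.AllPairs.Properties as APP
open import Data.Product using (_,_; proj₁; proj₂; ∃-syntax)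
open import Data.Sum using (_⊎_; inj₁; inj₂; [_,_]′)
open import Function using (_∘_)
open import Relation.Nullary using (¬_; Dec; yes; no; ¬?; contradiction)
open import Relation.Nullary.Decidable using (_⊎-dec_; _×-dec_)
open import Relation.Binary.Definitions using (tri<; tri≈; tri>)
open import Relation.Binary.PropositionalEquality
  using (_≡_; refl; sym; trans; cong; subst; subst₂; _≢_; module ≡-Reasoning)
open import Data.Nat.Tactic.RingSolver using (solve-∀)

module Chunks {A : Set} where

  AllBefore : (A → A → Set) → List A → List A → Set
  AllBefore R xs ys = ∀ {a b} → a ∈ xs → b ∈ ys → R a b

  take-⊆ : ∀ k (xs : List A) → take k xs ⊆ xs
  take-⊆ (suc k) (x ∷ xs) (here eq) = here eq
  take-⊆ (suc k) (x ∷ xs) (there a∈) = there (take-⊆ k xs a∈)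

  drop-⊆ : ∀ k (xs : List A) → drop k xs ⊆ xs
  drop-⊆ zero xs a∈ = a∈
  drop-⊆ (suc k) (x ∷ xs) a∈ = there (drop-⊆ k xs a∈)

  take-before-drop : ∀ {R : A → A → Set} k (xs : List A) → AllPairs R xs →
    AllBefore R (take k xs) (drop k xs)
  take-before-drop (suc k) (x ∷ xs) (x≺ ∷ _) (here refl) b∈ =
    All.lookup x≺ (drop-⊆ k xs b∈)
  take-before-drop (suc k) (x ∷ xs) (_ ∷ sorted) (there a∈) b∈ =
    take-before-drop k xs sorted a∈ b∈

  chunk : ℕ → List A → ℕ → List A
  chunk b xs zero = take b xs
  chunk b xs (suc v) = chunk b (drop b xs) v

  chunk-⊆ : ∀ b xs v → chunk b xs v ⊆ xs
  chunk-⊆ b xs zero = take-⊆ b xs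
  chunk-⊆ b xs (suc v) = drop-⊆ b xs ∘ chunk-⊆ b (drop b xs) v

  chunk-sorted : ∀ {R : A → A → Set} b xs v → AllPairs R xs → AllPairs R (chunk b xs v)
  chunk-sorted b xs zero sorted = APP.take⁺ b sorted
  chunk-sorted b xs (suc v) sorted = chunk-sorted b (drop b xs) v (APP.drop⁺ b sorted)

  chunk-before : ∀ {R : A → A → Set} b xs u v → AllPairs R xs → u < v →
    AllBefore R (chunk b xs u) (chunk b xs v)
  chunk-before b xs zero (suc v) sorted _ a∈ b∈ =
    take-before-drop b xs sorted a∈ (chunk-⊆ b (drop b xs) v b∈)
  chunk-before b xs (suc u) (suc v) sorted (s≤s u<v) =
    chunk-before b (drop b xs) u v (APP.drop⁺ b sorted) u<v

  chunk-length : ∀ b (xs : List A) k v → v < k → k * b ≤ length xs →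
    length (chunk b xs v) ≡ b
  chunk-length b xs (suc k) zero _ room =
    trans (LP.length-take b xs) (ℕ.m≤n⇒m⊓n≡m (ℕ.≤-trans (ℕ.m≤m+n b (k * b)) room))
  chunk-length b xs (suc k) (suc v) (s≤s v<k) room =
    chunk-length b (drop b xs) k v v<k rest
    where
    rest : k * b ≤ length (drop b xs)
    rest = subst (k * b ≤_) (sym (LP.length-drop b xs))
      (ℕ.m+n≤o⇒m≤o∸n (k * b) (subst (_≤ length xs) (ℕ.+-comm b (k * b)) room))

  length-filter-split : ∀ {P : A → Set} (P? : ∀ x → Dec (P x)) xs →
    length (filter P? xs) + length (filter (¬? ∘ P?) xs) ≡ length xs
  length-filter-split P? [] = refl
  length-filter-split P? (x ∷ xs) with P? x
  ... | yes _ = cong suc (length-filter-split P? xs)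
  ... | no _ = trans (ℕ.+-suc _ _) (cong suc (length-filter-split P? xs))

  increasingTuple : ∀ {R : A → A → Set} k (xs : List A) → AllPairs R xs → k ≤ length xs →
    Σ (Fin k → A) λ f → (∀ u v → u F.< v → R (f u) (f v)) × (∀ u → f u ∈ xs)
  increasingTuple zero xs _ _ = (λ ()) , (λ ()) , (λ ())
  increasingTuple {R} (suc k) (x ∷ xs) (x≺ ∷ sorted) (s≤s k≤) =
    g , increasing , member
    where
    tuple : Σ (Fin k → A) λ f → (∀ u v → u F.< v → R (f u) (f v)) × (∀ u → f u ∈ xs)
    tuple = increasingTuple k xs sorted k≤
    g : Fin (suc k) → A
    g F.zero = x
    g (F.suc u) = proj₁ tuple u
    increasing : ∀ u v → u F.< v → R (g u) (g v)
    increasing F.zero (F.suc v) _ = All.lookup x≺ (proj₂ (proj₂ tuple) v)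
    increasing (F.suc u) (F.suc v) (s≤s u<v) = proj₁ (proj₂ tuple) u v u<v
    member : ∀ u → g u ∈ (x ∷ xs)
    member F.zero = here refl
    member (F.suc u) = there (proj₂ (proj₂ tuple) u)
open Chunks

extendAfter : {A : Set} → (ℕ → A) → ℕ → A → ℕ → A
extendAfter g i x k with k ≤? i
... | yes _ = g k
... | no _ = x

extendAfter-old : {A : Set} (g : ℕ → A) {i k : ℕ} (x : A) → k ≤ i →
  extendAfter g i x k ≡ g k
extendAfter-old g {i} {k} x k≤i with k ≤? i
... | yes _ = refl
... | no k≰i = contradiction k≤i k≰i

extendAfter-new : {A : Set} (g : ℕ → A) (i : ℕ) (x : A) → extendAfter g i x (suc i) ≡ x
extendAfter-new g i x with suc i ≤? i
... | yes i+1≤i = contradiction i+1≤i ℕ.1+n≰n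
... | no _ = refl

pathThreshold : ℕ → ℕ → ℕ
pathThreshold m zero = 1
pathThreshold m (suc L) = m * (pathThreshold m L + (pathThreshold m L ∸ 1))

pathThreshold-positive : ∀ {m} → 1 ≤ m → ∀ L → 1 ≤ pathThreshold m L
pathThreshold-positive 1≤m zero = ℕ.≤-refl
pathThreshold-positive {m} 1≤m (suc L) = ℕ.*-mono-≤ 1≤m
  (ℕ.≤-trans (pathThreshold-positive 1≤m L) (ℕ.m≤m+n (pathThreshold m L) _))

-- h(x+1) ≤ m (2m)^x, since h(L+1) ≤ 2m h(L).
pathThreshold-bound : ∀ m x → pathThreshold m (suc x) ≤ m * (2 * m) ^ x
pathThreshold-bound m zero = ℕ.≤-refl
pathThreshold-bound m (suc x) = begin
  m * (h + (h ∸ 1))          ≤⟨ ℕ.*-monoʳ-≤ m (ℕ.+-monoʳ-≤ h (ℕ.m∸n≤m h 1)) ⟩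
  m * (h + h)                ≡⟨ cong (λ k → m * (h + k)) (sym (ℕ.+-identityʳ h)) ⟩
  m * (2 * h)                ≤⟨ ℕ.*-monoʳ-≤ m (ℕ.*-monoʳ-≤ 2 (pathThreshold-bound m x)) ⟩
  m * (2 * (m * (2 * m) ^ x)) ≡⟨ cong (m *_) (sym (ℕ.*-assoc 2 m ((2 * m) ^ x))) ⟩
  m * ((2 * m) * (2 * m) ^ x) ∎
  where
  open ℕ.≤-Reasoning
  h : ℕ
  h = pathThreshold m (suc x)

-- Two colours: an ordered path or a large independent set

module PathOrIndependent {N : ℕ} (E : Fin N → Fin N → Set)
  (E? : ∀ a b → Dec (E a b)) {m : ℕ} (π : Permutation′ m) (1≤m : 1 ≤ m) where

  V : Set
  V = Fin N

  Increasing : List V → Set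
  Increasing = AllPairs F._<_

  -- a and b are joined by an edge (E is only read on ordered pairs).
  Adj : V → V → Set
  Adj a b = (a F.< b × E a b) ⊎ (b F.< a × E b a)

  Adj? : ∀ a b → Dec (Adj a b)
  Adj? a b = ((a F.<? b) ×-dec E? a b) ⊎-dec ((b F.<? a) ×-dec E? b a)

  Adj-sym : ∀ {a b} → Adj a b → Adj b a
  Adj-sym (inj₁ e) = inj₂ e
  Adj-sym (inj₂ e) = inj₁ e

  Adj-irrefl : ∀ {a} → ¬ Adj a a
  Adj-irrefl (inj₁ (a<a , _)) = ℕ.<-irrefl refl a<a
  Adj-irrefl (inj₂ (a<a , _)) = ℕ.<-irrefl refl a<a

  Adj⇒E : ∀ {a b} → a F.< b → Adj a b → E a b
  Adj⇒E _ (inj₁ (_ , e)) = e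
  Adj⇒E a<b (inj₂ (b<a , _)) = contradiction a<b (ℕ.<-asym b<a)

  Independent : List V → Set
  Independent Y = ∀ {a b} → a ∈ Y → b ∈ Y → ¬ Adj a b

  record IndependentIn (X : List V) (k : ℕ) : Set where
    field
      members : List V
      increasing : Increasing members
      inside : members ⊆ X
      independent : Independent members
      large : k ≤ length members
  open IndependentIn

  PathIn : Set
  PathIn = Σ (Fin m → V) λ f → (∀ u v → u F.< v → f u F.< f v) ×
    (∀ u v → u F.< v → Edge (pathOrd m π) u v → E (f u) (f v))

  widen : ∀ {Y X k} → Y ⊆ X → IndependentIn Y k → IndependentIn X k
  widen Y⊆X I = record
    { members = members I ; increasing = increasing I ; inside = Y⊆X ∘ inside I
    ; independent = independent I ; large = large I }

  join : ∀ {X k} (I J : IndependentIn X k) →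
    AllBefore F._<_ (members I) (members J) →
    (∀ {a b} → a ∈ members I → b ∈ members J → ¬ Adj a b) →
    IndependentIn X (2 * k)
  join {X} {k} I J before apart = record
    { members = members I ++ members J
    ; increasing = APP.++⁺ (increasing I) (increasing J)
        (All.tabulate λ a∈ → All.tabulate λ b∈ → before a∈ b∈)
    ; inside = λ a∈ → [ inside I , inside J ]′ (MP.∈-++⁻ (members I) a∈)
    ; independent = λ a∈ b∈ → pairs (MP.∈-++⁻ (members I) a∈) (MP.∈-++⁻ (members I) b∈)
    ; large = subst (2 * k ≤_) (sym (LP.length-++ (members I)))
        (subst (_≤ length (members I) + length (members J))
          (cong (k +_) (sym (ℕ.+-identityʳ k))) (ℕ.+-mono-≤ (large I) (large J)))
    }
    where
    pairs : ∀ {a b} → (a ∈ members I) ⊎ (a ∈ members J) →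
      (b ∈ members I) ⊎ (b ∈ members J) → ¬ Adj a b
    pairs (inj₁ a∈) (inj₁ b∈) = independent I a∈ b∈
    pairs (inj₁ a∈) (inj₂ b∈) = apart a∈ b∈
    pairs (inj₂ a∈) (inj₁ b∈) = apart b∈ a∈ ∘ Adj-sym
    pairs (inj₂ a∈) (inj₂ b∈) = independent J a∈ b∈

  chunkFor : ℕ → ℕ
  chunkFor i with i <? m
  ... | yes i<m = toℕ (π ⟨$⟩ʳ fromℕ< i<m)
  ... | no _ = 0

  chunkFor-fromℕ< : ∀ {i} (i<m : i < m) → chunkFor i ≡ toℕ (π ⟨$⟩ʳ fromℕ< i<m)
  chunkFor-fromℕ< {i} i<m with i <? m
  ... | yes _ = refl
  ... | no i≮m = contradiction i<m i≮m

  chunkFor-< : ∀ i → chunkFor i < m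
  chunkFor-< i with i <? m
  ... | yes i<m = FP.toℕ<n (π ⟨$⟩ʳ fromℕ< i<m)
  ... | no _ = 1≤m

  chunkFor-injective : ∀ {i i'} → i < m → i' < m → chunkFor i ≡ chunkFor i' → i ≡ i'
  chunkFor-injective {i} {i'} i<m i'<m same = begin
    i                                       ≡⟨ sym (FP.toℕ-fromℕ< i<m) ⟩
    toℕ (fromℕ< i<m)                        ≡⟨ cong toℕ (sym (inverseˡ π)) ⟩
    toℕ (π ⟨$⟩ˡ (π ⟨$⟩ʳ fromℕ< i<m))        ≡⟨ cong (toℕ ∘ (π ⟨$⟩ˡ_)) sameImage ⟩
    toℕ (π ⟨$⟩ˡ (π ⟨$⟩ʳ fromℕ< i'<m))       ≡⟨ cong toℕ (inverseˡ π) ⟩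
    toℕ (fromℕ< i'<m)                       ≡⟨ FP.toℕ-fromℕ< i'<m ⟩
    i'                                      ∎
    where
    open ≡-Reasoning
    sameImage : π ⟨$⟩ʳ fromℕ< i<m ≡ π ⟨$⟩ʳ fromℕ< i'<m
    sameImage = FP.toℕ-injective
      (trans (sym (chunkFor-fromℕ< i<m)) (trans same (chunkFor-fromℕ< i'<m)))

  position : Fin m → ℕ
  position v = toℕ (π ⟨$⟩ˡ v)

  chunkFor-position : ∀ v → chunkFor (position v) ≡ toℕ v
  chunkFor-position v = trans (chunkFor-fromℕ< (FP.toℕ<n (π ⟨$⟩ˡ v)))
    (cong toℕ (trans (cong (π ⟨$⟩ʳ_) (FP.fromℕ<-toℕ (π ⟨$⟩ˡ v) _)) (inverseʳ π)))

  position≤ : ∀ v → position v ≤ m ∸ 1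
  position≤ v = ℕ.∸-monoˡ-≤ 1 (FP.toℕ<n (π ⟨$⟩ˡ v))

  module Step (L : ℕ) (X : List V) (X-increasing : Increasing X)
    (X-large : pathThreshold m (suc L) ≤ length X)
    (IH : ∀ Y → Increasing Y → pathThreshold m L ≤ length Y →
      PathIn ⊎ IndependentIn Y (2 ^ L)) where

    h b : ℕ
    h = pathThreshold m L
    b = h + (h ∸ 1)

    block : ℕ → List V
    block i = chunk b X (chunkFor i)

    block-⊆ : ∀ i → block i ⊆ X
    block-⊆ i = chunk-⊆ b X (chunkFor i)

    block-increasing : ∀ i → Increasing (block i)
    block-increasing i = chunk-sorted b X (chunkFor i) X-increasing

    block-length : ∀ i → length (block i) ≡ b
    block-length i = chunk-length b X m (chunkFor i) (chunkFor-< i) X-large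

    blocks-separated : ∀ i i' → i < m → i' < m → i ≢ i' →
      AllBefore F._<_ (block i) (block i') ⊎ AllBefore F._<_ (block i') (block i)
    blocks-separated i i' i<m i'<m i≢i' with ℕ.<-cmp (chunkFor i) (chunkFor i')
    ... | tri< lt _ _ = inj₁ (chunk-before b X _ _ X-increasing lt)
    ... | tri≈ _ eq _ = contradiction (chunkFor-injective i<m i'<m eq) i≢i'
    ... | tri> _ _ gt = inj₂ (chunk-before b X _ _ X-increasing gt)

    record Walk (i : ℕ) (x : V) : Set where
      field
        vertexAt : ℕ → V
        ends : vertexAt i ≡ x
        inBlock : ∀ k → k ≤ i → vertexAt k ∈ block k
        adjacent : ∀ k → k < i → Adj (vertexAt k) (vertexAt (suc k))
    open Walk

    extendWalk : ∀ {i x y} → Walk i y → Adj y x → x ∈ block (suc i) → Walk (suc i) x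
    extendWalk {i} {x} w y~x x∈ = record
      { vertexAt = g
      ; ends = extendAfter-new (vertexAt w) i x
      ; inBlock = inBlock′
      ; adjacent = adjacent′
      }
      where
      g : ℕ → V
      g = extendAfter (vertexAt w) i x
      old : ∀ {k} → k ≤ i → g k ≡ vertexAt w k
      old = extendAfter-old (vertexAt w) x
      inBlock′ : ∀ k → k ≤ suc i → g k ∈ block k
      inBlock′ k k≤ with ℕ.m≤n⇒m<n∨m≡n k≤
      ... | inj₁ (s≤s k≤i) = subst (_∈ block k) (sym (old k≤i)) (inBlock w k k≤i)
      ... | inj₂ refl = subst (_∈ block (suc i)) (sym (extendAfter-new (vertexAt w) i x)) x∈
      adjacent′ : ∀ k → k < suc i → Adj (g k) (g (suc k))
      adjacent′ k (s≤s k≤i) with ℕ.m≤n⇒m<n∨m≡n k≤i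
      ... | inj₁ k<i = subst₂ Adj (sym (old k≤i)) (sym (old k<i)) (adjacent w k k<i)
      ... | inj₂ refl = subst₂ Adj (sym (trans (old ℕ.≤-refl) (ends w)))
                          (sym (extendAfter-new (vertexAt w) k x)) y~x

    walkToPath : ∀ {x} → Walk (m ∸ 1) x → PathIn
    walkToPath w = f , f-increasing , f-edge
      where
      f : Fin m → V
      f v = vertexAt w (position v)
      f-chunk : ∀ v → f v ∈ chunk b X (toℕ v)
      f-chunk v = subst (λ z → f v ∈ chunk b X z) (chunkFor-position v)
        (inBlock w (position v) (position≤ v))
      f-increasing : ∀ u v → u F.< v → f u F.< f v
      f-increasing u v u<v = chunk-before b X _ _ X-increasing u<v (f-chunk u) (f-chunk v)
      step : ∀ {u v} → suc (position u) ≡ position v → Adj (f u) (f v)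
      step {u} {v} next = subst (Adj (f u) ∘ vertexAt w) next
        (adjacent w (position u) (subst (_≤ m ∸ 1) (sym next) (position≤ v)))
      f-edge : ∀ u v → u F.< v → Edge (pathOrd m π) u v → E (f u) (f v)
      f-edge u v u<v (inj₁ next) = Adj⇒E (f-increasing u v u<v) (step next)
      f-edge u v u<v (inj₂ next) = Adj⇒E (f-increasing u v u<v) (Adj-sym (step next))

    record Frontier (i : ℕ) : Set where
      field
        front : List V
        front-increasing : Increasing front
        front-⊆ : front ⊆ block i
        reached : ∀ {x} → x ∈ front → Walk i x
        front-large : h ≤ length front
    open Frontier

    Outcome : Set
    Outcome = PathIn ⊎ IndependentIn X (2 ^ suc L)

    firstFrontier : Frontier 0
    firstFrontier = record
      { front = block 0
      ; front-increasing = block-increasing 0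
      ; front-⊆ = λ x∈ → x∈
      ; reached = λ {x} x∈ → record
          { vertexAt = λ _ → x ; ends = refl
          ; inBlock = λ { zero z≤n → x∈ } ; adjacent = λ _ () }
      ; front-large = subst (h ≤_) (sym (block-length 0)) (ℕ.m≤m+n h (h ∸ 1))
      }

    Linked : List V → V → Set
    Linked C y = Any (λ x → Adj x y) C

    linked? : ∀ C y → Dec (Linked C y)
    linked? C y = any? (λ x → Adj? x y) C

    grown stranded : List V → ℕ → List V
    grown C i = filter (linked? C) (block (suc i))
    stranded C i = filter (¬? ∘ linked? C) (block (suc i))

    grown-large : ∀ C i → ¬ (h ≤ length (stranded C i)) → h ≤ length (grown C i)
    grown-large C i short = ℕ.+-cancelʳ-≤ (length (stranded C i)) h (length (grown C i)) (begin
      h + length (stranded C i)                      ≤⟨ ℕ.+-monoʳ-≤ h (ℕ.<⇒≤pred (ℕ.≰⇒> short)) ⟩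
      b                                              ≡⟨ sym (block-length (suc i)) ⟩
      length (block (suc i))                         ≡⟨ sym (length-filter-split (linked? C) (block (suc i))) ⟩
      length (grown C i) + length (stranded C i)     ∎)
      where open ℕ.≤-Reasoning

    nextFrontier : ∀ {i} (Φ : Frontier i) → ¬ (h ≤ length (stranded (front Φ) i)) →
      Frontier (suc i)
    nextFrontier {i} Φ short = record
      { front = grown C i
      ; front-increasing = APP.filter⁺ (linked? C) (block-increasing (suc i))
      ; front-⊆ = filter-⊆ (linked? C) (block (suc i))
      ; reached = reached′
      ; front-large = grown-large C i short
      }
      where
      C : List V
      C = front Φ
      reached′ : ∀ {x} → x ∈ grown C i → Walk (suc i) x
      reached′ x∈ with MP.∈-filter⁻ (linked? C) {xs = block (suc i)} x∈
      ... | x∈block , link with find link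
      ... | y , y∈C , y~x = extendWalk (reached Φ y∈C) y~x x∈block

    merge : ∀ {i} → suc i < m → (Φ : Frontier i) →
      IndependentIn (front Φ) (2 ^ L) → IndependentIn (stranded (front Φ) i) (2 ^ L) →
      IndependentIn X (2 ^ suc L)
    merge {i} si<m Φ I J = orient
      (blocks-separated i (suc i) (ℕ.<-trans (ℕ.n<1+n i) si<m) si<m (ℕ.<⇒≢ (ℕ.n<1+n i)))
      where
      C : List V
      C = front Φ
      inI : members I ⊆ block i
      inI = front-⊆ Φ ∘ inside I
      inJ : members J ⊆ block (suc i)
      inJ = filter-⊆ (¬? ∘ linked? C) (block (suc i)) ∘ inside J
      I′ J′ : IndependentIn X (2 ^ L)
      I′ = widen (block-⊆ i ∘ front-⊆ Φ) I
      J′ = widen (block-⊆ (suc i) ∘ filter-⊆ (¬? ∘ linked? C) (block (suc i))) J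
      apart : ∀ {a b} → a ∈ members I → b ∈ members J → ¬ Adj a b
      apart a∈ b∈ a~b = proj₂ (MP.∈-filter⁻ (¬? ∘ linked? C) {xs = block (suc i)} (inside J b∈))
        (lose (inside I a∈) a~b)
      orient : AllBefore F._<_ (block i) (block (suc i)) ⊎ AllBefore F._<_ (block (suc i)) (block i) →
        IndependentIn X (2 ^ suc L)
      orient (inj₁ before) = join I′ J′ (λ a∈ b∈ → before (inI a∈) (inJ b∈)) apart
      orient (inj₂ after) = join J′ I′ (λ b∈ a∈ → after (inJ b∈) (inI a∈))
        (λ b∈ a∈ → apart a∈ b∈ ∘ Adj-sym)

    advance : ∀ {i} → suc i < m → Frontier i → Outcome ⊎ Frontier (suc i)
    advance {i} si<m Φ with IH (front Φ) (front-increasing Φ) (front-large Φ)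
    ... | inj₁ path = inj₁ (inj₁ path)
    ... | inj₂ I with h ≤? length (stranded (front Φ) i)
    ...   | no short = inj₂ (nextFrontier Φ short)
    ...   | yes long with IH _ (APP.filter⁺ (¬? ∘ linked? (front Φ)) (block-increasing (suc i))) long
    ...     | inj₁ path = inj₁ (inj₁ path)
    ...     | inj₂ J = inj₁ (inj₂ (merge si<m Φ I J))

    frontier : ∀ i → i < m → Outcome ⊎ Frontier i
    frontier zero _ = inj₂ firstFrontier
    frontier (suc i) si<m with frontier i (ℕ.<-trans (ℕ.n<1+n i) si<m)
    ... | inj₁ outcome = inj₁ outcome
    ... | inj₂ Φ = advance si<m Φ

    outcome : Outcome
    outcome with frontier (m ∸ 1) (ℕ.∸-monoʳ-< {o = 0} (s≤s z≤n) 1≤m)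
    ... | inj₁ o = o
    ... | inj₂ Φ with front Φ | reached Φ | front-large Φ
    ...   | x ∷ _ | walks | _ = inj₁ (walkToPath (walks (here refl)))
    ...   | [] | _ | h≤0 = contradiction (ℕ.≤-trans (pathThreshold-positive 1≤m L) h≤0) λ ()

  pathOrIndependent : ∀ L X → Increasing X → pathThreshold m L ≤ length X →
    PathIn ⊎ IndependentIn X (2 ^ L)
  pathOrIndependent zero (x ∷ _) _ _ = inj₂ record
    { members = x ∷ []
    ; increasing = All.[] ∷ []
    ; inside = λ { (here refl) → here refl }
    ; independent = λ { (here refl) (here refl) → Adj-irrefl }
    ; large = ℕ.≤-refl
    }
  pathOrIndependent (suc L) X X-increasing X-large =
    Step.outcome L X X-increasing X-large (pathOrIndependent L)

-- Many colours: induction on the number of colours in use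

module ColourInduction (n p s : ℕ) (π : Permutation′ (2 ^ p)) (ℓ : ℕ → ℕ)
  (ℓ-base : ℓ zero ≡ n) (ℓ-step : ∀ r → pathThreshold (2 ^ p) (ℓ r) ≤ 2 ^ ℓ (suc r))
  {N : ℕ} (c : Colouring N (suc s)) where

  Goal : Set
  Goal = ∃[ j ] ContainedIn (familyKP n p s π j) c j

  ColoursAtMost : ℕ → List (Fin N) → Set
  ColoursAtMost r X = ∀ {a b} → a ∈ X → b ∈ X → a F.< b → toℕ (c a b) ≤ r

  colour-induction : ∀ r → r ≤ s → ∀ X → AllPairs F._<_ X → ColoursAtMost r X →
    2 ^ ℓ r ≤ length X → Goal
  colour-induction zero _ X X-increasing colours X-large
    with increasingTuple (2 ^ n) X X-increasing (subst (λ e → 2 ^ e ≤ length X) ℓ-base X-large)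
  ... | f , f-increasing , f-in = F.zero , f , f-increasing , λ u v u<v _ →
    FP.toℕ-injective (ℕ.n≤0⇒n≡0 (colours (f-in u) (f-in v) (f-increasing u v u<v)))
  colour-induction (suc r) r<s X X-increasing colours X-large =
    descend (pathOrIndependent (ℓ r) X X-increasing (ℕ.≤-trans (ℓ-step r) X-large))
    where
    top : Fin (suc s)
    top = fromℕ< (s≤s r<s)
    open PathOrIndependent (λ a b → c a b ≡ top) (λ a b → c a b F.≟ top) π (ℕ.m^n>0 2 p)
    -- The top colour is absent from an independent set of its graph.
    lower : (I : IndependentIn X (2 ^ ℓ r)) → ColoursAtMost r (IndependentIn.members I)
    lower I a∈ b∈ a<b = ℕ.≤-pred (ℕ.≤∧≢⇒< (colours (inside a∈) (inside b∈) a<b) λ is-top →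
      independent a∈ b∈ (inj₁ (a<b , FP.toℕ-injective (trans is-top (sym (FP.toℕ-fromℕ< (s≤s r<s)))))))
      where open IndependentIn I
    descend : PathIn ⊎ IndependentIn X (2 ^ ℓ r) → Goal
    descend (inj₁ path) = top , path
    descend (inj₂ I) = colour-induction r (ℕ.<⇒≤ r<s) members increasing (lower I) large
      where open IndependentIn I

  complete : 2 ^ ℓ s ≤ N → Goal
  complete N-large = colour-induction s ℕ.≤-refl (allFin N) (APP.tabulate⁺-< λ i<j → i<j)
    (λ _ _ _ → ℕ.≤-pred (FP.toℕ<n _)) (subst (2 ^ ℓ s ≤_) (sym (LP.length-tabulate _)) N-large)

module Levels (n' p' : ℕ) where

  p : ℕ
  p = suc p'

  -- level r = depth r + 1 satisfies level 0 = n, level (r+1) = (p+1) level r - 1.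
  depth : ℕ → ℕ
  depth zero = n'
  depth (suc r) = suc p * depth r + p'

  level : ℕ → ℕ
  level r = suc (depth r)

  level-step : ∀ r → pathThreshold (2 ^ p) (level r) ≤ 2 ^ level (suc r)
  level-step r = begin
    pathThreshold (2 ^ p) (level r)   ≤⟨ pathThreshold-bound (2 ^ p) (depth r) ⟩
    2 ^ p * (2 ^ suc p) ^ depth r     ≡⟨ cong (2 ^ p *_) (ℕ.^-*-assoc 2 (suc p) (depth r)) ⟩
    2 ^ p * 2 ^ (suc p * depth r)     ≡⟨ sym (ℕ.^-distribˡ-+-* 2 p (suc p * depth r)) ⟩
    2 ^ (p + suc p * depth r)         ≡⟨ cong (λ e → 2 ^ suc e) (ℕ.+-comm p' (suc p * depth r)) ⟩
    2 ^ level (suc r)                 ∎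
    where open ℕ.≤-Reasoning

  exponent : ∀ r → suc p ^ r * (suc n' * p ∸ 1) ≡ p' + p * depth r
  exponent zero = trans (ℕ.+-identityʳ _) (cong (p' +_) (ℕ.*-comm n' p))
  exponent (suc r) = begin
    suc p * suc p ^ r * (suc n' * p ∸ 1)   ≡⟨ ℕ.*-assoc (suc p) (suc p ^ r) _ ⟩
    suc p * (suc p ^ r * (suc n' * p ∸ 1)) ≡⟨ cong (suc p *_) (exponent r) ⟩
    suc p * (p' + p * depth r)             ≡⟨ regroup p' (depth r) ⟩
    p' + p * depth (suc r)                 ∎
    where
    open ≡-Reasoning
    regroup : ∀ q d → suc (suc q) * (q + suc q * d) ≡ q + suc q * (suc (suc q) * d + q)
    regroup = solve-∀

  level-power : ∀ s → (2 ^ level s) ^ p ≡ 2 ^ (suc p ^ s * (suc n' * p ∸ 1) + 1)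
  level-power s = trans (ℕ.^-*-assoc 2 (level s) p) (cong (2 ^_) (begin
    suc (depth s) * p         ≡⟨ times-p p' (depth s) ⟩
    (p' + p * depth s) + 1    ≡⟨ cong (_+ 1) (sym (exponent s)) ⟩
    suc p ^ s * (suc n' * p ∸ 1) + 1 ∎))
    where
    open ≡-Reasoning
    times-p : ∀ q d → suc d * suc q ≡ (q + suc q * d) + 1
    times-p = solve-∀

lemma6 : (n p s : ℕ) → 1 ≤ n → 1 ≤ p → (π : Permutation′ (2 ^ p)) →
    Σ ℕ λ N →
      (N ^ p ≤ 2 ^ ((suc p ^ s) * (n * p ∸ 1) + 1)) ×
      Arrows {suc s} (familyKP n p s π) N
lemma6 (suc n') (suc p') s _ _ π =
  2 ^ level s , ℕ.≤-reflexive (level-power s) ,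
  λ c → ColourInduction.complete (suc n') (suc p') s π level refl level-step c ℕ.≤-refl
  where open Levels n' p'
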